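{- Let $G$ be a bridgeless cubic graph. Then $G$ has a 5-CDC in which one colour class is a 2-factor of $G$ if and only if $\tau(G)\le 4$.
   Context: An even subgraph is a subgraph in which every vertex has even degree (a disjoint union of cycles). A $k$-CDC of $G$ is a collection of $k$ even subgraphs (colour classes) of $G$ such that every edge of $G$ lies in exactly two of them. A 2-factor is a spanning 2-regular subgraph. The perfect matching index $\tau(G)$ of a bridgeless cubic graph is the smallest integer $k$ such that there exist perfect matchings $M_1,\dots,M_k$ of $G$ with $M_1\cup\dots\cup M_k=E(G)$. -}

module Defs where

open import Data.Nat using (ℕ; zero; suc; _+_; _*_; _≤_)
open import Data.Fin using (Fin; zero; suc; _≟_)
open import Data.Bool using (Bool; true; false; if_then_else_; _∨_; _∧_; not)
open import Data.Product using (Σ; ∃; _×_; _,_)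
open import Data.Sum using (_⊎_)
open import Relation.Nullary using (¬_)
open import Relation.Nullary.Decidable using (⌊_⌋)
open import Relation.Binary.PropositionalEquality using (_≡_; _≢_)

-- A finite loopless multigraph: vertices Fin n, edges Fin m, each edge
-- has two distinct endpoints (parallel edges allowed).
record Graph : Set where
  field
    n   : ℕ
    m   : ℕ
    src : Fin m → Fin n
    tgt : Fin m → Fin n
    loopless : ∀ e → src e ≢ tgt e
open Graph public

EdgeSet : Graph → Set
EdgeSet G = Fin (m G) → Bool

count : ∀ {k} → (Fin k → Bool) → ℕ
count {zero} f = 0
count {suc k} f = (if f zero then 1 else 0) + count (λ i → f (suc i))

incident : (G : Graph) → Fin (m G) → Fin (n G) → Bool
incident G e x = ⌊ src G e ≟ x ⌋ ∨ ⌊ tgt G e ≟ x ⌋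

degIn : (G : Graph) → EdgeSet G → Fin (n G) → ℕ
degIn G S x = count (λ e → S e ∧ incident G e x)

full : (G : Graph) → EdgeSet G
full G e = true

deg : (G : Graph) → Fin (n G) → ℕ
deg G = degIn G (full G)

Cubic : Graph → Set
Cubic G = ∀ x → deg G x ≡ 3

data Connected (G : Graph) (S : EdgeSet G) : Fin (n G) → Fin (n G) → Set where
  here : ∀ {x} → Connected G S x x
  step : ∀ {x y z} (e : Fin (m G)) → S e ≡ true →
         ((src G e ≡ x × tgt G e ≡ y) ⊎ (tgt G e ≡ x × src G e ≡ y)) →
         Connected G S y z → Connected G S x z

without : (G : Graph) → Fin (m G) → EdgeSet G
without G e f = not ⌊ e ≟ f ⌋

IsBridge : (G : Graph) → Fin (m G) → Set
IsBridge G e = ¬ Connected G (without G e) (src G e) (tgt G e)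

Bridgeless : Graph → Set
Bridgeless G = ∀ e → ¬ IsBridge G e

Even : ℕ → Set
Even k = ∃ λ j → k ≡ 2 * j

EvenSubgraph : (G : Graph) → EdgeSet G → Set
EvenSubgraph G S = ∀ x → Even (degIn G S x)

IsCDC : (G : Graph) (k : ℕ) → (Fin k → EdgeSet G) → Set
IsCDC G k C = (∀ i → EvenSubgraph G (C i)) ×
              (∀ e → count (λ i → C i e) ≡ 2)

TwoFactor : (G : Graph) → EdgeSet G → Set
TwoFactor G S = ∀ x → degIn G S x ≡ 2

PerfectMatching : (G : Graph) → EdgeSet G → Set
PerfectMatching G M = ∀ x → degIn G M x ≡ 1

PMCover : (G : Graph) (k : ℕ) → Set
PMCover G k = Σ (Fin k → EdgeSet G) λ M →
  (∀ i → PerfectMatching G (M i)) × (∀ e → Σ (Fin k) λ i → M i e ≡ true)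

-- τ(G) ≤ k : the least size of a perfect-matching cover is at most k,
-- i.e. some cover of size ≤ k exists
τ≤ : Graph → ℕ → Set
τ≤ G k = Σ ℕ λ j → j ≤ k × PMCover G j

Has5CDCWith2Factor : Graph → Set
Has5CDCWith2Factor G = Σ (Fin 5 → EdgeSet G) λ C →
  IsCDC G 5 C × Σ (Fin 5) λ i → TwoFactor G (C i)

-- Let C₀,…,C₄ be a 5-CDC in which C_{i₀} is a 2-factor. At every vertex C_{i₀} contains two of the
-- three edges and every other class C_j an even number of them. C_j cannot contain the same two
-- edges: these would then lie in no class besides C_{i₀} and C_j, so by evenness no class could
-- contain the third edge. Hence the complement of C_{i₀} △ C_j meets every vertex exactly once, and
-- these four perfect matchings cover E(G) because every edge lies in exactly two classes.
-- Conversely, if perfect matchings M₁,…,M₄ cover E(G), the multiplicities of the three edges at a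
-- vertex are positive and sum to 4, so they are 2, 1, 1 in some order. The edges covered once thus
-- form a 2-factor F, and F together with the complements of F △ M₁, …, F △ M₄ is a 5-CDC.
module Submission where

open import Defs
open import Data.Nat using (ℕ; zero; suc; _+_; _≤_; z≤n; s≤s; _≡ᵇ_)
open import Data.Nat.Properties
  using (≤-refl; +-suc; +-cancelˡ-≡; +-cancelʳ-≡; 0≢1+n; suc-injective; even≢odd;
         m≤n⇒∃[o]m+o≡n; +-commutativeSemigroup)
open import Data.Nat.Tactic.RingSolver using (solve-∀)
open import Data.Fin using (Fin; zero; suc; _≟_; punchIn; punchOut; splitAt; _↑ˡ_)
open import Data.Fin.Properties using (punchInᵢ≢i; punchIn-punchOut; splitAt-↑ˡ)
open import Data.Bool using (Bool; true; false; if_then_else_; _∧_; not)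
open import Data.Bool.Properties using (∧-identityʳ; ∧-zeroʳ; ⇔→≡)
open import Function.Bundles using (mk⇔)
open import Data.Vec.Functional using (_∷_; []; updateAt)
open import Data.Vec.Functional.Properties using (updateAt-updates; updateAt-minimal)
open import Data.Product using (Σ; ∃; _×_; _,_; proj₁; proj₂)
open import Data.Sum using (_⊎_; inj₁; inj₂; [_,_]′)
open import Data.Empty using (⊥; ⊥-elim)
open import Function using (_∘_; id; const)
open import Relation.Nullary using (¬_; yes; no)
open import Relation.Binary.PropositionalEquality
open import Algebra.Properties.CommutativeSemigroup +-commutativeSemigroup using (x∙yz≈y∙xz)

private variable
  k d : ℕ

infixl 6 _-_
_-_ : (Fin k → Bool) → Fin k → Fin k → Bool
p - i = updateAt p i (const false)

count-remove : (p : Fin k → Bool) (i : Fin k) → count p ≡ (if p i then 1 else 0) + count (p - i)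
count-remove p zero = refl
count-remove p (suc i) = trans (cong ((if p zero then 1 else 0) +_) (count-remove (p ∘ suc) i))
                               (x∙yz≈y∙xz (if p zero then 1 else 0) (if p (suc i) then 1 else 0) _)

count-remove-true : (p : Fin k → Bool) {i : Fin k} → p i ≡ true → count p ≡ suc (count (p - i))
count-remove-true p {i} pi rewrite count-remove p i | pi = refl

count-nonzero : (p : Fin k → Bool) → count p ≡ suc d → ∃ λ i → p i ≡ true
count-nonzero {suc k} p eq with p zero in p₀
... | true  = zero , p₀
... | false = let i , pi = count-nonzero (p ∘ suc) eq in suc i , pi

remove-others : (p : Fin k → Bool) {i j : Fin k} → j ≢ i → (p - i) j ≡ p j
remove-others p {i} {j} j≢i = updateAt-minimal j i p j≢i

remainder-nonzero : (p : Fin k → Bool) (i : Fin k) → count p ≡ suc (suc d) →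
  ∃ λ d′ → count (p - i) ≡ suc d′
remainder-nonzero {d = d} p i cp with p i | count-remove p i
... | true  | eq = d , suc-injective (trans (sym eq) cp)
... | false | eq = suc d , trans (sym eq) cp

another-point : (p : Fin k → Bool) → count p ≡ suc (suc d) →
  ∀ i → ∃ λ j → i ≢ j × p j ≡ true
another-point p cp i with count-nonzero (p - i) (proj₂ (remainder-nonzero p i cp))
... | j , pj = j , i≢j , trans (sym (remove-others p (≢-sym i≢j))) pj
  where
  i≢j : i ≢ j
  i≢j refl with () ← trans (sym (updateAt-updates i p)) pj

pair-unique : (p : Fin k → Bool) {i j l : Fin k} → count p ≡ 2 → i ≢ j →
  p i ≡ true → p j ≡ true → p l ≡ true → l ≡ i ⊎ l ≡ j
pair-unique p {i} {j} {l} cp i≢j pi pj pl with l ≟ i | l ≟ j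
... | yes l≡i | _       = inj₁ l≡i
... | no  _   | yes l≡j = inj₂ l≡j
... | no  l≢i | no  l≢j =
  ⊥-elim (0≢1+n (trans (sym rest-empty) (count-remove-true (p - i - j) pl″)))
  where
  pl″ : (p - i - j) l ≡ true
  pl″ = trans (remove-others (p - i) l≢j) (trans (remove-others p l≢i) pl)
  rest-empty : count (p - i - j) ≡ 0
  rest-empty = suc-injective (suc-injective (begin
    suc (suc (count (p - i - j)))  ≡⟨ cong suc (count-remove-true (p - i) pj′) ⟨
    suc (count (p - i))            ≡⟨ count-remove-true p pi ⟨
    count p                        ≡⟨ cp ⟩
    2                              ∎))
    where
    open ≡-Reasoning
    pj′ : (p - i) j ≡ true
    pj′ = trans (remove-others p (≢-sym i≢j)) pj

pairs-equal : (p q : Fin k → Bool) {i j : Fin k} → count p ≡ 2 → count q ≡ 2 → i ≢ j →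
  p i ≡ true → p j ≡ true → q i ≡ true → q j ≡ true → ∀ l → p l ≡ q l
pairs-equal p q {i} {j} cp cq i≢j pi pj qi qj l =
  ⇔→≡ (mk⇔ (at q qi qj ∘ pair-unique p cp i≢j pi pj)
            (at p pi pj ∘ pair-unique q cq i≢j qi qj))
  where
  at : ∀ r → r i ≡ true → r j ≡ true → l ≡ i ⊎ l ≡ j → r l ≡ true
  at r ri rj = [ (λ l≡i → subst (λ x → r x ≡ true) (sym l≡i) ri) ,
                 (λ l≡j → subst (λ x → r x ≡ true) (sym l≡j) rj) ]′

count-not : (p : Fin k → Bool) → count (not ∘ p) + count p ≡ k
count-not {zero}  p = refl
count-not {suc k} p with p zero
... | true  = trans (+-suc _ _) (cong suc (count-not (p ∘ suc)))
... | false = cong suc (count-not (p ∘ suc))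

-- Phrased through count so that degIn at a vertex of a cubic graph unfolds to it definitionally.
weight3 : Bool → Bool → Bool → ℕ
weight3 x y z = count (x ∷ y ∷ z ∷ [])

agree : Bool → Bool → Bool
agree x y = if x then y else not y

data OneOfThree (x y z : Bool) : Set where
  just₁ : x ≡ true  → y ≡ false → z ≡ false → OneOfThree x y z
  just₂ : x ≡ false → y ≡ true  → z ≡ false → OneOfThree x y z
  just₃ : x ≡ false → y ≡ false → z ≡ true  → OneOfThree x y z

data TwoOfThree (x y z : Bool) : Set where
  all-but₁ : x ≡ false → y ≡ true  → z ≡ true  → TwoOfThree x y z
  all-but₂ : x ≡ true  → y ≡ false → z ≡ true  → TwoOfThree x y z
  all-but₃ : x ≡ true  → y ≡ true  → z ≡ false → TwoOfThree x y z

data EvenOfThree (x y z : Bool) : Set where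
  none : x ≡ false → y ≡ false → z ≡ false → EvenOfThree x y z
  two  : TwoOfThree x y z → EvenOfThree x y z

oneOfThree : ∀ {x y z} → weight3 x y z ≡ 1 → OneOfThree x y z
oneOfThree {true}  {false} {false} _ = just₁ refl refl refl
oneOfThree {false} {true}  {false} _ = just₂ refl refl refl
oneOfThree {false} {false} {true}  _ = just₃ refl refl refl
oneOfThree {true}  {true}          ()
oneOfThree {true}  {false} {true}  ()
oneOfThree {false} {true}  {true}  ()
oneOfThree {false} {false} {false} ()

weight-oneOfThree : ∀ {x y z} → OneOfThree x y z → weight3 x y z ≡ 1
weight-oneOfThree (just₁ refl refl refl) = refl
weight-oneOfThree (just₂ refl refl refl) = refl
weight-oneOfThree (just₃ refl refl refl) = refl

twoOfThree : ∀ {x y z} → weight3 x y z ≡ 2 → TwoOfThree x y z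
twoOfThree {false} {true}  {true}  _ = all-but₁ refl refl refl
twoOfThree {true}  {false} {true}  _ = all-but₂ refl refl refl
twoOfThree {true}  {true}  {false} _ = all-but₃ refl refl refl
twoOfThree {true}  {true}  {true}  ()
twoOfThree {true}  {false} {false} ()
twoOfThree {false} {true}  {false} ()
twoOfThree {false} {false} {true}  ()
twoOfThree {false} {false} {false} ()

weight-twoOfThree : ∀ {x y z} → TwoOfThree x y z → weight3 x y z ≡ 2
weight-twoOfThree (all-but₁ refl refl refl) = refl
weight-twoOfThree (all-but₂ refl refl refl) = refl
weight-twoOfThree (all-but₃ refl refl refl) = refl

evenOfThree : ∀ {x y z} → Even (weight3 x y z) → EvenOfThree x y z
evenOfThree {false} {false} {false} _ = none refl refl refl
evenOfThree {false} {true}  {true}  _ = two (all-but₁ refl refl refl)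
evenOfThree {true}  {false} {true}  _ = two (all-but₂ refl refl refl)
evenOfThree {true}  {true}  {false} _ = two (all-but₃ refl refl refl)
evenOfThree {true}  {false} {false} (j , eq) = ⊥-elim (even≢odd j 0 (sym eq))
evenOfThree {false} {true}  {false} (j , eq) = ⊥-elim (even≢odd j 0 (sym eq))
evenOfThree {false} {false} {true}  (j , eq) = ⊥-elim (even≢odd j 0 (sym eq))
evenOfThree {true}  {true}  {true}  (j , eq) = ⊥-elim (even≢odd j 1 (sym eq))

even-weight : ∀ {x y z} → EvenOfThree x y z → Even (weight3 x y z)
even-weight (none refl refl refl) = 0 , refl
even-weight (two t)               = 1 , weight-twoOfThree t

even-forces : ∀ {x y z} → EvenOfThree x y z →
  (x ≡ y → z ≡ false) × (x ≡ z → y ≡ false) × (y ≡ z → x ≡ false)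
even-forces (none refl refl refl)           = (λ _ → refl) , (λ _ → refl) , (λ _ → refl)
even-forces (two (all-but₁ refl refl refl)) = (λ ())       , (λ ())       , (λ _ → refl)
even-forces (two (all-but₂ refl refl refl)) = (λ ())       , (λ _ → refl) , (λ ())
even-forces (two (all-but₃ refl refl refl)) = (λ _ → refl) , (λ ())       , (λ ())

agree-two-one : ∀ {x y z x′ y′ z′} → TwoOfThree x y z → OneOfThree x′ y′ z′ →
  EvenOfThree (agree x x′) (agree y y′) (agree z z′)
agree-two-one (all-but₁ refl refl refl) (just₁ refl refl refl) = none refl refl refl
agree-two-one (all-but₁ refl refl refl) (just₂ refl refl refl) = two (all-but₃ refl refl refl)
agree-two-one (all-but₁ refl refl refl) (just₃ refl refl refl) = two (all-but₂ refl refl refl)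
agree-two-one (all-but₂ refl refl refl) (just₁ refl refl refl) = two (all-but₃ refl refl refl)
agree-two-one (all-but₂ refl refl refl) (just₂ refl refl refl) = none refl refl refl
agree-two-one (all-but₂ refl refl refl) (just₃ refl refl refl) = two (all-but₁ refl refl refl)
agree-two-one (all-but₃ refl refl refl) (just₁ refl refl refl) = two (all-but₂ refl refl refl)
agree-two-one (all-but₃ refl refl refl) (just₂ refl refl refl) = two (all-but₁ refl refl refl)
agree-two-one (all-but₃ refl refl refl) (just₃ refl refl refl) = none refl refl refl

agree-two-even : ∀ {x y z x′ y′ z′} → TwoOfThree x y z → EvenOfThree x′ y′ z′ →
  ¬ (x ≡ x′ × y ≡ y′ × z ≡ z′) → OneOfThree (agree x x′) (agree y y′) (agree z z′)
agree-two-even (all-but₁ refl refl refl) (none refl refl refl)           _ = just₁ refl refl refl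
agree-two-even (all-but₁ refl refl refl) (two (all-but₁ refl refl refl)) d =
  ⊥-elim (d (refl , refl , refl))
agree-two-even (all-but₁ refl refl refl) (two (all-but₂ refl refl refl)) _ = just₃ refl refl refl
agree-two-even (all-but₁ refl refl refl) (two (all-but₃ refl refl refl)) _ = just₂ refl refl refl
agree-two-even (all-but₂ refl refl refl) (none refl refl refl)           _ = just₂ refl refl refl
agree-two-even (all-but₂ refl refl refl) (two (all-but₁ refl refl refl)) _ = just₃ refl refl refl
agree-two-even (all-but₂ refl refl refl) (two (all-but₂ refl refl refl)) d =
  ⊥-elim (d (refl , refl , refl))
agree-two-even (all-but₂ refl refl refl) (two (all-but₃ refl refl refl)) _ = just₁ refl refl refl
agree-two-even (all-but₃ refl refl refl) (none refl refl refl)           _ = just₃ refl refl refl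
agree-two-even (all-but₃ refl refl refl) (two (all-but₁ refl refl refl)) _ = just₂ refl refl refl
agree-two-even (all-but₃ refl refl refl) (two (all-but₂ refl refl refl)) _ = just₁ refl refl refl
agree-two-even (all-but₃ refl refl refl) (two (all-but₃ refl refl refl)) d =
  ⊥-elim (d (refl , refl , refl))

count-partition : {f g h : Fin k → Bool} → (∀ i → OneOfThree (f i) (g i) (h i)) →
  count f + (count g + count h) ≡ k
count-partition {zero}  _    = refl
count-partition {suc k} {f} {g} {h} part = trans
  (interchange (if f zero then 1 else 0) (if g zero then 1 else 0) (if h zero then 1 else 0)
               (count (f ∘ suc)) (count (g ∘ suc)) (count (h ∘ suc)))
  (cong₂ _+_ (weight-oneOfThree (part zero)) (count-partition (part ∘ suc)))
  where
  interchange : ∀ a b c x y z → (a + x) + ((b + y) + (c + z)) ≡ (a + (b + (c + 0))) + (x + (y + z))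
  interchange = solve-∀

Enumerates : {k m : ℕ} → (Fin m → Bool) → (Fin k → Fin m) → Set
Enumerates f v = (∀ g → count (λ e → g e ∧ f e) ≡ count (g ∘ v)) ×
                  (∀ e → f e ≡ true → ∃ λ i → v i ≡ e)

enumerate : ∀ {m} (f : Fin m → Bool) → Σ (Fin (count f) → Fin m) (Enumerates f)
enumerate {zero}  f = (λ ()) , (λ _ → refl) , (λ ())
enumerate {suc m} f = extend (f zero) refl (enumerate (f ∘ suc))
  where
  extend : ∀ b → f zero ≡ b → Σ (Fin (count (f ∘ suc)) → Fin m) (Enumerates (f ∘ suc)) →
           Σ (Fin ((if b then 1 else 0) + count (f ∘ suc)) → Fin (suc m)) (Enumerates f)
  extend true f₀ (v , counts , covers) = (zero ∷ suc ∘ v) , counts′ , covers′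
    where
    counts′ : ∀ g → count (λ e → g e ∧ f e) ≡ count (g ∘ (zero ∷ suc ∘ v))
    counts′ g rewrite f₀ | ∧-identityʳ (g zero) = cong (_ +_) (counts (g ∘ suc))
    covers′ : ∀ e → f e ≡ true → ∃ λ i → (zero ∷ suc ∘ v) i ≡ e
    covers′ zero    _  = zero , refl
    covers′ (suc e) fe = let i , vi = covers e fe in suc i , cong suc vi
  extend false f₀ (v , counts , covers) = suc ∘ v , counts′ , covers′
    where
    counts′ : ∀ g → count (λ e → g e ∧ f e) ≡ count (g ∘ suc ∘ v)
    counts′ g rewrite f₀ | ∧-zeroʳ (g zero) = counts (g ∘ suc)
    covers′ : ∀ e → f e ≡ true → ∃ λ i → suc (v i) ≡ e
    covers′ zero    f₀′ with () ← trans (sym f₀) f₀′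
    covers′ (suc e) fe = let i , vi = covers e fe in i , cong suc vi

enumerate-≡ : ∀ {m} (f : Fin m → Bool) → count f ≡ k → Σ (Fin k → Fin m) (Enumerates f)
enumerate-≡ f refl = enumerate f

record Star (G : Graph) (x : Fin (n G)) : Set where
  field
    e₁ e₂ e₃ : Fin (m G)
    degree   : ∀ S → degIn G S x ≡ weight3 (S e₁) (S e₂) (S e₃)
    incident⇒ : ∀ e → incident G e x ≡ true → e ≡ e₁ ⊎ e ≡ e₂ ⊎ e ≡ e₃

  incident-elim : (P : Fin (m G) → Set) → P e₁ → P e₂ → P e₃ →
                  ∀ e → incident G e x ≡ true → P e
  incident-elim P p₁ p₂ p₃ e inc with incident⇒ e inc
  ... | inj₁ refl        = p₁
  ... | inj₂ (inj₁ refl) = p₂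
  ... | inj₂ (inj₂ refl) = p₃

star : (G : Graph) → Cubic G → ∀ x → Star G x
star G cubic x with enumerate-≡ (λ e → incident G e x) (cubic x)
... | v , counts , covers = record
  { e₁ = v zero ; e₂ = v (suc zero) ; e₃ = v (suc (suc zero))
  ; degree = counts
  ; incident⇒ = λ e inc → position (covers e inc)
  }
  where
  position : ∀ {e} → ∃ (λ i → v i ≡ e) →
             e ≡ v zero ⊎ e ≡ v (suc zero) ⊎ e ≡ v (suc (suc zero))
  position (zero , refl)             = inj₁ refl
  position (suc zero , refl)         = inj₂ (inj₁ refl)
  position (suc (suc zero) , refl)   = inj₂ (inj₂ refl)

incident-src : (G : Graph) (e : Fin (m G)) → incident G e (src G e) ≡ true
incident-src G e with src G e ≟ src G e
... | yes _  = refl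
... | no ¬eq = ⊥-elim (¬eq refl)

shared-pair-isolates : {p q r : Fin k → Bool} {i j : Fin k} →
  count p ≡ 2 → count q ≡ 2 → count r ≡ 2 → i ≢ j →
  p i ≡ true → p j ≡ true → q i ≡ true → q j ≡ true →
  ¬ (∀ l → p l ≡ q l → r l ≡ false)
shared-pair-isolates {p = p} {q} {r} cp cq cr i≢j pi pj qi qj third
  with l , rl ← count-nonzero r cr
  with () ← trans (sym rl) (third l (pairs-equal p q cp cq i≢j pi pj qi qj l))

classes-differ : {p q r : Fin k → Bool} {i j : Fin k} →
  count p ≡ 2 → count q ≡ 2 → count r ≡ 2 → (∀ l → EvenOfThree (p l) (q l) (r l)) →
  i ≢ j → TwoOfThree (p i) (q i) (r i) → ¬ (p i ≡ p j × q i ≡ q j × r i ≡ r j)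
classes-differ cp cq cr even i≢j (all-but₁ _ qi ri) (_ , qij , rij) =
  shared-pair-isolates cq cr cp i≢j qi (trans (sym qij) qi) ri (trans (sym rij) ri)
    (λ l → proj₂ (proj₂ (even-forces (even l))))
classes-differ cp cq cr even i≢j (all-but₂ pi _ ri) (pij , _ , rij) =
  shared-pair-isolates cp cr cq i≢j pi (trans (sym pij) pi) ri (trans (sym rij) ri)
    (λ l → proj₁ (proj₂ (even-forces (even l))))
classes-differ cp cq cr even i≢j (all-but₃ pi qi _) (pij , qij , _) =
  shared-pair-isolates cp cq cr i≢j pi (trans (sym pij) pi) qi (trans (sym qij) qi)
    (λ l → proj₁ (even-forces (even l)))

agreeing-class : (p : Fin 5 → Bool) → count p ≡ 2 →
  ∀ i → ∃ λ j → i ≢ j × agree (p i) (p j) ≡ true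
agreeing-class p cp i with p i
... | true  = another-point p cp i
... | false = another-point (not ∘ p) three-outside i
  where
  three-outside : count (not ∘ p) ≡ 3
  three-outside = +-cancelʳ-≡ 2 _ 3 (trans (cong (count (not ∘ p) +_) (sym cp)) (count-not p))

module FromColouring (G : Graph) (cubic : Cubic G) (C : Fin 5 → EdgeSet G) (cdc : IsCDC G 5 C)
                     (i₀ : Fin 5) (factor : TwoFactor G (C i₀)) where

  matching : Fin 4 → EdgeSet G
  matching k e = agree (C i₀ e) (C (punchIn i₀ k) e)

  perfect : ∀ k → PerfectMatching G (matching k)
  perfect k x = trans (degree (matching k)) (weight-oneOfThree (agree-two-even pair₀ (even j) differ))
    where
    open Star (star G cubic x)
    j : Fin 5
    j = punchIn i₀ k
    even : ∀ l → EvenOfThree (C l e₁) (C l e₂) (C l e₃)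
    even l = evenOfThree (subst Even (degree (C l)) (proj₁ cdc l x))
    pair₀ : TwoOfThree (C i₀ e₁) (C i₀ e₂) (C i₀ e₃)
    pair₀ = twoOfThree (trans (sym (degree (C i₀))) (factor x))
    differ : ¬ (C i₀ e₁ ≡ C j e₁ × C i₀ e₂ ≡ C j e₂ × C i₀ e₃ ≡ C j e₃)
    differ = classes-differ (proj₂ cdc e₁) (proj₂ cdc e₂) (proj₂ cdc e₃) even
                            (≢-sym (punchInᵢ≢i i₀ k)) pair₀

  covering : ∀ e → ∃ λ k → matching k e ≡ true
  covering e with j , i₀≢j , agrees ← agreeing-class (λ i → C i e) (proj₂ cdc e) i₀ =
    punchOut i₀≢j ,
    subst (λ l → agree (C i₀ e) (C l e) ≡ true) (sym (punchIn-punchOut i₀≢j)) agrees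

  τ≤4 : τ≤ G 4
  τ≤4 = 4 , ≤-refl , matching , perfect , covering

data OneDoubled (x y z : ℕ) : Set where
  doubled₁ : x ≡ 2 → y ≡ 1 → z ≡ 1 → OneDoubled x y z
  doubled₂ : x ≡ 1 → y ≡ 2 → z ≡ 1 → OneDoubled x y z
  doubled₃ : x ≡ 1 → y ≡ 1 → z ≡ 2 → OneDoubled x y z

one-doubled : ∀ {x y z} → 1 ≤ x → 1 ≤ y → 1 ≤ z → x + (y + z) ≡ 4 → OneDoubled x y z
one-doubled {suc x} {suc y} {suc z} (s≤s _) (s≤s _) (s≤s _) eq =
  shape (+-cancelˡ-≡ 3 _ _ (trans (sym (pull-suc x y z)) eq))
  where
  pull-suc : ∀ x y z → suc x + (suc y + suc z) ≡ 3 + (x + (y + z))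
  pull-suc = solve-∀
  shape : ∀ {x y z} → x + (y + z) ≡ 1 → OneDoubled (suc x) (suc y) (suc z)
  shape {1} {0} {0} _ = doubled₁ refl refl refl
  shape {0} {1} {0} _ = doubled₂ refl refl refl
  shape {0} {0} {1} _ = doubled₃ refl refl refl

OneOrTwo : ℕ → Set
OneOrTwo x = x ≡ 1 ⊎ x ≡ 2

one-doubled-bounds : ∀ {x y z} → OneDoubled x y z → OneOrTwo x × OneOrTwo y × OneOrTwo z
one-doubled-bounds (doubled₁ refl refl refl) = inj₂ refl , inj₁ refl , inj₁ refl
one-doubled-bounds (doubled₂ refl refl refl) = inj₁ refl , inj₂ refl , inj₁ refl
one-doubled-bounds (doubled₃ refl refl refl) = inj₁ refl , inj₁ refl , inj₂ refl

once-twoOfThree : ∀ {x y z} → OneDoubled x y z → TwoOfThree (x ≡ᵇ 1) (y ≡ᵇ 1) (z ≡ᵇ 1)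
once-twoOfThree (doubled₁ refl refl refl) = all-but₁ refl refl refl
once-twoOfThree (doubled₂ refl refl refl) = all-but₂ refl refl refl
once-twoOfThree (doubled₃ refl refl refl) = all-but₃ refl refl refl

classes-through : (p : Fin 4 → Bool) → OneOrTwo (count p) →
  (if count p ≡ᵇ 1 then 1 else 0) + count (λ k → agree (count p ≡ᵇ 1) (p k)) ≡ 2
classes-through p (inj₁ cp) rewrite cp = cong suc cp
classes-through p (inj₂ cp) rewrite cp =
  +-cancelʳ-≡ 2 _ 2 (trans (cong (count (not ∘ p) +_) (sym cp)) (count-not p))

module FromMatchings (G : Graph) (cubic : Cubic G) (N : Fin 4 → EdgeSet G)
                     (perfect : ∀ k → PerfectMatching G (N k))
                     (covering : ∀ e → ∃ λ k → N k e ≡ true) where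

  multiplicity : Fin (m G) → ℕ
  multiplicity e = count (λ k → N k e)

  once : EdgeSet G
  once e = multiplicity e ≡ᵇ 1

  colouring : Fin 5 → EdgeSet G
  colouring zero    = once
  colouring (suc k) e = agree (once e) (N k e)

  multiplicity-positive : ∀ e → 1 ≤ multiplicity e
  multiplicity-positive e with k , Nke ← covering e
    rewrite count-remove-true (λ k → N k e) Nke = s≤s z≤n

  module AtVertex (x : Fin (n G)) where
    open Star (star G cubic x) public

    matching-pattern : ∀ k → OneOfThree (N k e₁) (N k e₂) (N k e₃)
    matching-pattern k = oneOfThree (trans (sym (degree (N k))) (perfect k x))

    one-doubled-at : OneDoubled (multiplicity e₁) (multiplicity e₂) (multiplicity e₃)
    one-doubled-at =
      one-doubled (multiplicity-positive e₁) (multiplicity-positive e₂) (multiplicity-positive e₃)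
        (count-partition {f = λ k → N k e₁} {λ k → N k e₂} {λ k → N k e₃} matching-pattern)

    once-pair : TwoOfThree (once e₁) (once e₂) (once e₃)
    once-pair = once-twoOfThree one-doubled-at

  multiplicity-bounded : ∀ e → OneOrTwo (multiplicity e)
  multiplicity-bounded e =
    let b₁ , b₂ , b₃ = one-doubled-bounds one-doubled-at
    in incident-elim (OneOrTwo ∘ multiplicity) b₁ b₂ b₃ e (incident-src G e)
    where open AtVertex (src G e)

  factor : TwoFactor G once
  factor x = trans (degree once) (weight-twoOfThree once-pair)
    where open AtVertex x

  even : ∀ i → EvenSubgraph G (colouring i)
  even zero    x = subst Even (sym (degree once)) (even-weight (two once-pair))
    where open AtVertex x
  even (suc k) x = subst Even (sym (degree (colouring (suc k))))
      (even-weight (agree-two-one once-pair (matching-pattern k)))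
    where open AtVertex x

  twice : ∀ e → count (λ i → colouring i e) ≡ 2
  twice e = classes-through (λ k → N k e) (multiplicity-bounded e)

  has5CDC : Has5CDCWith2Factor G
  has5CDC = colouring , (even , twice) , zero , factor

PMCover-≤ : (G : Graph) → Cubic G → ∀ {j} → j ≤ k → PMCover G j → PMCover G k
-- A cubic graph covered by no perfect matching has no edges, hence no vertices.
PMCover-≤ G cubic {zero} _ (_ , _ , covering) =
  (λ _ _ → false) ,
  (λ _ x → ⊥-elim (no-edge (proj₁ (count-nonzero _ (cubic x))))) ,
  ⊥-elim ∘ no-edge
  where
  no-edge : Fin (m G) → ⊥
  no-edge e with () , _ ← covering e
PMCover-≤ G cubic {suc j} j≤k (M , perfect , covering) with d , refl ← m≤n⇒∃[o]m+o≡n j≤k =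
  M ∘ retract , perfect ∘ retract , covering′
  where
  retract : Fin (suc j + d) → Fin (suc j)
  retract l = [ id , const zero ]′ (splitAt (suc j) l)
  covering′ : ∀ e → ∃ λ l → M (retract l) e ≡ true
  covering′ e with i , Mie ← covering e =
    i ↑ˡ d , subst (λ s → M ([ id , const zero ]′ s) e ≡ true) (sym (splitAt-↑ˡ (suc j) i d)) Mie

theorem5p2 : (G : Graph) → Cubic G → Bridgeless G →
    (Has5CDCWith2Factor G → τ≤ G 4) × (τ≤ G 4 → Has5CDCWith2Factor G)
theorem5p2 G cubic _ = from-colouring , from-matchings
  where
  from-colouring : Has5CDCWith2Factor G → τ≤ G 4
  from-colouring (C , cdc , i₀ , factor) = FromColouring.τ≤4 G cubic C cdc i₀ factor
  from-matchings : τ≤ G 4 → Has5CDCWith2Factor G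
  from-matchings (j , j≤4 , cover) with N , perfect , covering ← PMCover-≤ G cubic j≤4 cover =
    FromMatchings.has5CDC G cubic N perfect covering
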